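{- Let $\div: Th(\mathbf{RCbr})\times\mathbb L\to Th(\mathbf{RCbr})$ be an extensional AGM$\circ$ contraction over $\mathbf{RCbr}$. Then $\div$ also satisfies: (vacuity) for every belief set $K$ and formula $\alpha$, if $\alpha\notin K$ then $K\div\alpha=K$; (recovery) for every belief set $K$ and formula $\alpha$, $K\subseteq Cn((K\div\alpha)\cup\{\alpha\})$.
   Context: Formulas ($\mathbb L$ denotes the set of all formulas) are built from a denumerable set of propositional variables using binary $\wedge,\vee,\rightarrow$ and unary $\neg,\circ$; $\alpha\leftrightarrow\beta$ abbreviates $(\alpha\rightarrow\beta)\wedge(\beta\rightarrow\alpha)$. The logic $\mathbf{Cbr}$ is the Hilbert calculus with modus ponens as only rule and axiom schemas: (1) $\alpha\rightarrow(\beta\rightarrow\alpha)$; (2) $(\alpha\rightarrow(\beta\rightarrow\gamma))\rightarrow((\alpha\rightarrow\beta)\rightarrow(\alpha\rightarrow\gamma))$; (3) $\alpha\rightarrow(\beta\rightarrow(\alpha\wedge\beta))$; (4) $(\alpha\wedge\beta)\rightarrow\alpha$; (5) $(\alpha\wedge\beta)\rightarrow\beta$; (6) $\alpha\rightarrow(\alpha\vee\beta)$; (7) $\beta\rightarrow(\alpha\vee\beta)$; (8) $(\alpha\rightarrow\gamma)\rightarrow((\beta\rightarrow\gamma)\rightarrow((\alpha\vee\beta)\rightarrow\gamma))$; (9) $(\alpha\rightarrow\beta)\vee\alpha$; (10) $\alpha\vee\neg\alpha$; (11) $\circ\alpha\rightarrow(\alpha\rightarrow(\neg\alpha\rightarrow\beta))$;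 (12) $\circ\alpha\vee(\alpha\wedge\neg\alpha)$; (13) $\alpha\rightarrow\neg\neg\alpha$; (14) $\neg\neg\alpha\rightarrow\alpha$. $\mathbf{RCbr}$ is $\mathbf{Cbr}$ plus the rules "from $\alpha\leftrightarrow\beta$ infer $\neg\alpha\leftrightarrow\neg\beta$" and "from $\alpha\leftrightarrow\beta$ infer $\circ\alpha\leftrightarrow\circ\beta$", applicable only to theorems: $\vdash_{\mathbf{RCbr}}\alpha$ means $\alpha$ is derivable without premises; for a set $\Gamma$, $\Gamma\vdash_{\mathbf{RCbr}}\alpha$ means either $\vdash_{\mathbf{RCbr}}\alpha$ or there are $\gamma_1,\dots,\gamma_n\in\Gamma$ with $\vdash_{\mathbf{RCbr}}(\gamma_1\wedge\dots\wedge\gamma_n)\rightarrow\alpha$. $Cn(\Gamma)=\{\alpha:\Gamma\vdash_{\mathbf{RCbr}}\alpha\}$; $\alpha\equiv\beta$ means $\vdash_{\mathbf{RCbr}}\alpha\leftrightarrow\beta$. $Th(\mathbf{RCbr})$ is the set of belief sets, i.e. sets $K$ with $K=Cn(K)$. For a belief set $K$, $\alpha$ is unrevocable in $K$ (written $U_K(\alpha)$) if $\vdash_{\mathbf{RCbr}}\alpha$ or $\circ\alpha\in K$; otherwise revocable ($R_K(\alpha)$). An extensional AGM$\circ$ contraction over $\mathbf{RCbr}$ is a function $\div: Th(\mathbf{RCbr})\times\mathbb L\to Th(\mathbf{RCbr})$ satisfying, for all $K,\alpha,\beta$: (closure) $K\div\alpha=Cn(K\div\alpha)$; (success) if $R_K(\alpha)$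 then $\alpha\notin K\div\alpha$; (inclusion) $K\div\alpha\subseteq K$; (failure) if $\circ\alpha\in K$ then $K\div\alpha=K$; (relevance) if $\beta\in K\setminus(K\div\alpha)$ then there is a set $X$ with $K\div\alpha\subseteq Cn(X)\subseteq K$, $\alpha\notin Cn(X)$ and $\alpha\in Cn(Cn(X)\cup\{\beta\})$; (extensionality) if $\alpha\equiv\beta$ then $K\div\alpha=K\div\beta$. -}

module Defs where

open import Data.Nat using (ℕ)
open import Data.List using (List; []; _∷_)
open import Data.List.NonEmpty using (List⁺; _∷_; toList)
open import Data.List.Relation.Unary.All using (All)
open import Data.Product using (Σ; _×_; _,_; proj₁; ∃)
open import Data.Sum using (_⊎_)
open import Relation.Nullary using (¬_)
open import Level using (0ℓ)

infixr 5 _⇒_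
infixr 6 _∨_
infixr 7 _∧_

data Formula : Set where
  var : ℕ → Formula
  _∧_ _∨_ _⇒_ : Formula → Formula → Formula
  ~_ : Formula → Formula      -- paraconsistent negation ¬
  ∘_ : Formula → Formula      -- consistency operator ∘

_⇔_ : Formula → Formula → Formula
α ⇔ β = (α ⇒ β) ∧ (β ⇒ α)

data ⊢_ : Formula → Set where
  ax1  : ∀ {α β} → ⊢ (α ⇒ (β ⇒ α))
  ax2  : ∀ {α β γ} → ⊢ ((α ⇒ (β ⇒ γ)) ⇒ ((α ⇒ β) ⇒ (α ⇒ γ)))
  ax3  : ∀ {α β} → ⊢ (α ⇒ (β ⇒ (α ∧ β)))
  ax4  : ∀ {α β} → ⊢ ((α ∧ β) ⇒ α)
  ax5  : ∀ {α β} → ⊢ ((α ∧ β) ⇒ β)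
  ax6  : ∀ {α β} → ⊢ (α ⇒ (α ∨ β))
  ax7  : ∀ {α β} → ⊢ (β ⇒ (α ∨ β))
  ax8  : ∀ {α β γ} → ⊢ ((α ⇒ γ) ⇒ ((β ⇒ γ) ⇒ ((α ∨ β) ⇒ γ)))
  ax9  : ∀ {α β} → ⊢ ((α ⇒ β) ∨ α)
  ax10 : ∀ {α} → ⊢ (α ∨ (~ α))
  ax11 : ∀ {α β} → ⊢ ((∘ α) ⇒ (α ⇒ ((~ α) ⇒ β)))
  ax12 : ∀ {α} → ⊢ ((∘ α) ∨ (α ∧ (~ α)))
  ax13 : ∀ {α} → ⊢ (α ⇒ (~ (~ α)))
  ax14 : ∀ {α} → ⊢ ((~ (~ α)) ⇒ α)
  mp   : ∀ {α β} → ⊢ α → ⊢ (α ⇒ β) → ⊢ β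
  rule¬ : ∀ {α β} → ⊢ (α ⇔ β) → ⊢ ((~ α) ⇔ (~ β))
  rule∘ : ∀ {α β} → ⊢ (α ⇔ β) → ⊢ ((∘ α) ⇔ (∘ β))

FSet : Set₁
FSet = Formula → Set

_⊆_ : FSet → FSet → Set
A ⊆ B = ∀ {φ} → A φ → B φ

_≐_ : FSet → FSet → Set
A ≐ B = (A ⊆ B) × (B ⊆ A)

_∪_ : FSet → FSet → FSet
(A ∪ B) φ = A φ ⊎ B φ

⟦_⟧ : Formula → FSet
⟦ α ⟧ φ = φ ≡' α
  where
  open import Relation.Binary.PropositionalEquality using () renaming (_≡_ to _≡'_)

⋀' : Formula → List Formula → Formula
⋀' γ [] = γ
⋀' γ (δ ∷ δs) = γ ∧ ⋀' δ δs

⋀ : List⁺ Formula → Formula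
⋀ (γ ∷ γs) = ⋀' γ γs

_⊢'_ : FSet → Formula → Set
Γ ⊢' α = (⊢ α) ⊎ (Σ (List⁺ Formula) λ γs → All Γ (toList γs) × (⊢ (⋀ γs ⇒ α)))

Cn : FSet → FSet
Cn Γ α = Γ ⊢' α

_≡ₗ_ : Formula → Formula → Set
α ≡ₗ β = ⊢ (α ⇔ β)

BeliefSet : Set₁
BeliefSet = Σ FSet λ K → K ≐ Cn K

_∈_ : Formula → FSet → Set
α ∈ A = A α

_∉_ : Formula → FSet → Set
α ∉ A = ¬ (A α)

Unrevocable : FSet → Formula → Set
Unrevocable K α = (⊢ α) ⊎ ((∘ α) ∈ K)

Revocable : FSet → Formula → Set
Revocable K α = ¬ Unrevocable K α

Contraction : Set₁
Contraction = BeliefSet → Formula → BeliefSet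

∣_∣ : BeliefSet → FSet
∣ K ∣ = proj₁ K

record IsExtensionalAGM∘ (_÷_ : Contraction) : Set₁ where
  field
    -- ÷ is a function on sets: equal belief sets give equal contractions
    well-defined  : ∀ K K' α → ∣ K ∣ ≐ ∣ K' ∣ → ∣ K ÷ α ∣ ≐ ∣ K' ÷ α ∣
    closure       : ∀ K α → ∣ K ÷ α ∣ ≐ Cn ∣ K ÷ α ∣
    success       : ∀ K α → Revocable ∣ K ∣ α → α ∉ ∣ K ÷ α ∣
    inclusion     : ∀ K α → ∣ K ÷ α ∣ ⊆ ∣ K ∣
    failure       : ∀ K α → (∘ α) ∈ ∣ K ∣ → ∣ K ÷ α ∣ ≐ ∣ K ∣
    relevance     : ∀ K α β → β ∈ ∣ K ∣ → β ∉ ∣ K ÷ α ∣ →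
                    Σ FSet λ X → (∣ K ÷ α ∣ ⊆ Cn X) × (Cn X ⊆ ∣ K ∣)
                                 × (α ∉ Cn X) × (α ∈ Cn (Cn X ∪ ⟦ β ⟧))
    extensionality : ∀ K α β → α ≡ₗ β → ∣ K ÷ α ∣ ≐ ∣ K ÷ β ∣

{-# OPTIONS --safe #-}
module Submission where

-- Relevance says that a formula β dropped from K ÷ α is needed to keep α out of
-- some subtheory Cn X ⊆ K, i.e. α ∈ Cn (Cn X ∪ {β}) while α ∉ Cn X; classically,
-- β is therefore retained as soon as no such X exists.  If α ∉ K there is none,
-- since Cn X ∪ {β} ⊆ K; this is vacuity.  For recovery take β ∈ K: then α ⇒ β ∈ K,
-- and α ∈ Cn (Cn X ∪ {α ⇒ β}) gives (α ⇒ β) ⇒ α ∈ Cn X by the deduction theorem,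
-- hence α ∈ Cn X by Peirce's law.  So α ⇒ β ∈ K ÷ α, and β follows from it and α.

open import Defs
open import Data.Product using (_×_; _,_; proj₂)
open import Level using (0ℓ)
open import Axiom.ExcludedMiddle using (ExcludedMiddle)
open import Axiom.DoubleNegationElimination using (em⇒dne)

open import Data.Sum using (inj₁; inj₂)
open import Data.List using ([]; _∷_; _++_)
open import Data.List.NonEmpty using (_∷_)
open import Data.List.Relation.Unary.All using (All; []; _∷_) renaming (map to All-map)
open import Data.List.Relation.Unary.All.Properties using (++⁺)
open import Relation.Binary.PropositionalEquality using (refl)

private
  variable
    α β γ : Formula
    Γ Δ : FSet

⊢-weaken : ⊢ β → ⊢ (α ⇒ β)
⊢-weaken ⊢β = mp ⊢β ax1

⊢-mp-under : ⊢ (α ⇒ (β ⇒ γ)) → ⊢ (α ⇒ β) → ⊢ (α ⇒ γ)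
⊢-mp-under ⊢α⇒β⇒γ ⊢α⇒β = mp ⊢α⇒β (mp ⊢α⇒β⇒γ ax2)

⊢-id : ⊢ (α ⇒ α)
⊢-id {α} = ⊢-mp-under (ax1 {α} {α ⇒ α}) ax1

⊢-trans : ⊢ (α ⇒ β) → ⊢ (β ⇒ γ) → ⊢ (α ⇒ γ)
⊢-trans ⊢α⇒β ⊢β⇒γ = ⊢-mp-under (⊢-weaken ⊢β⇒γ) ⊢α⇒β

⊢-∧-intro : ⊢ (α ⇒ β) → ⊢ (α ⇒ γ) → ⊢ (α ⇒ β ∧ γ)
⊢-∧-intro ⊢α⇒β ⊢α⇒γ = ⊢-mp-under (⊢-trans ⊢α⇒β ax3) ⊢α⇒γ

⊢-⇒-monoʳ : ⊢ (β ⇒ γ) → ⊢ ((α ⇒ β) ⇒ (α ⇒ γ))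
⊢-⇒-monoʳ ⊢β⇒γ = mp (⊢-weaken ⊢β⇒γ) ax2

⊢-⇒-distribʳ-∧ : ⊢ ((α ⇒ β) ∧ (α ⇒ γ) ⇒ (α ⇒ β ∧ γ))
⊢-⇒-distribʳ-∧ = ⊢-mp-under (⊢-mp-under (⊢-weaken ax2) (⊢-trans ax4 (⊢-⇒-monoʳ ax3))) ax5

⊢-modus-ponens : ⊢ ((α ⇒ β) ∧ α ⇒ β)
⊢-modus-ponens = ⊢-mp-under ax4 ax5

-- Eliminate the instance (α ⇒ β) ∨ α of axiom 9 under the hypothesis (α ⇒ β) ⇒ α.
⊢-peirce : ⊢ (((α ⇒ β) ⇒ α) ⇒ α)
⊢-peirce = ⊢-mp-under (⊢-mp-under (⊢-mp-under (⊢-weaken ax8) ⊢-id) (⊢-weaken ⊢-id)) (⊢-weaken ax9)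

⊢-⋀'-++ : ∀ γ γs δ δs → ⊢ (⋀' γ (γs ++ δ ∷ δs) ⇒ ⋀' γ γs) × ⊢ (⋀' γ (γs ++ δ ∷ δs) ⇒ ⋀' δ δs)
⊢-⋀'-++ γ []       δ δs = ax4 , ax5
⊢-⋀'-++ γ (ε ∷ εs) δ δs =
  let ⊢left , ⊢right = ⊢-⋀'-++ ε εs δ δs
  in ⊢-∧-intro ax4 (⊢-trans ax5 ⊢left) , ⊢-trans ax5 ⊢right

Cn-extensive : Γ ⊆ Cn Γ
Cn-extensive {φ = φ} φ∈Γ = inj₂ (φ ∷ [] , φ∈Γ ∷ [] , ⊢-id)

Cn-monotone : Γ ⊆ Δ → Cn Γ ⊆ Cn Δ
Cn-monotone Γ⊆Δ (inj₁ ⊢φ)               = inj₁ ⊢φ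
Cn-monotone Γ⊆Δ (inj₂ (γs , γs⊆Γ , ⊢φ)) = inj₂ (γs , All-map Γ⊆Δ γs⊆Γ , ⊢φ)

Cn-⊢ : Cn Γ α → ⊢ (α ⇒ β) → Cn Γ β
Cn-⊢ (inj₁ ⊢α)               ⊢α⇒β = inj₁ (mp ⊢α ⊢α⇒β)
Cn-⊢ (inj₂ (γs , γs⊆Γ , ⊢α)) ⊢α⇒β = inj₂ (γs , γs⊆Γ , ⊢-trans ⊢α ⊢α⇒β)

Cn-∧ : Cn Γ α → Cn Γ β → Cn Γ (α ∧ β)
Cn-∧ (inj₁ ⊢α) (inj₁ ⊢β) = inj₁ (mp ⊢β (mp ⊢α ax3))
Cn-∧ (inj₁ ⊢α) (inj₂ (δs , δs⊆Γ , ⊢β)) = inj₂ (δs , δs⊆Γ , ⊢-∧-intro (⊢-weaken ⊢α) ⊢β)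
Cn-∧ (inj₂ (γs , γs⊆Γ , ⊢α)) (inj₁ ⊢β) = inj₂ (γs , γs⊆Γ , ⊢-∧-intro ⊢α (⊢-weaken ⊢β))
Cn-∧ (inj₂ (γ ∷ γs , γs⊆Γ , ⊢α)) (inj₂ (δ ∷ δs , δs⊆Γ , ⊢β)) =
  let ⊢left , ⊢right = ⊢-⋀'-++ γ γs δ δs
  in inj₂ (γ ∷ (γs ++ δ ∷ δs) , ++⁺ γs⊆Γ δs⊆Γ , ⊢-∧-intro (⊢-trans ⊢left ⊢α) (⊢-trans ⊢right ⊢β))

Cn-mp : Cn Γ (α ⇒ β) → Cn Γ α → Cn Γ β
Cn-mp α⇒β∈Γ α∈Γ = Cn-⊢ (Cn-∧ α⇒β∈Γ α∈Γ) ⊢-modus-ponens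

Cn-deduction : Cn (Cn Γ ∪ ⟦ α ⟧) β → Cn Γ (α ⇒ β)
Cn-deduction (inj₁ ⊢β)                       = inj₁ (⊢-weaken ⊢β)
Cn-deduction (inj₂ (γ ∷ γs , γs⊆Γ+α , ⊢⋀γs⇒β)) = Cn-⊢ (premises γ γs γs⊆Γ+α) (⊢-⇒-monoʳ ⊢⋀γs⇒β)
  where
  premise : ∀ {γ} → (Cn Γ ∪ ⟦ α ⟧) γ → Cn Γ (α ⇒ γ)
  premise (inj₁ γ∈Γ) = Cn-⊢ γ∈Γ ax1
  premise (inj₂ refl) = inj₁ ⊢-id

  premises : ∀ γ γs → All (Cn Γ ∪ ⟦ α ⟧) (γ ∷ γs) → Cn Γ (α ⇒ ⋀' γ γs)
  premises γ []       (γ∈ ∷ [])  = premise γ∈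
  premises γ (δ ∷ δs) (γ∈ ∷ δs∈) = Cn-⊢ (Cn-∧ (premise γ∈) (premises δ δs δs∈)) ⊢-⇒-distribʳ-∧

∪-⟦⟧-⊆ : Γ ⊆ Δ → α ∈ Δ → (Γ ∪ ⟦ α ⟧) ⊆ Δ
∪-⟦⟧-⊆ Γ⊆Δ α∈Δ (inj₁ φ∈Γ) = Γ⊆Δ φ∈Γ
∪-⟦⟧-⊆ Γ⊆Δ α∈Δ (inj₂ refl) = α∈Δ

Cn-closed : (K : BeliefSet) → Cn ∣ K ∣ ⊆ ∣ K ∣
Cn-closed K = proj₂ (proj₂ K)

module _ (em : ExcludedMiddle 0ℓ) {_÷_ : Contraction} (agm : IsExtensionalAGM∘ _÷_) where

  open IsExtensionalAGM∘ agm

  retained-unless-relevant : ∀ K α → β ∈ ∣ K ∣ →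
    (∀ X → Cn X ⊆ ∣ K ∣ → α ∉ Cn X → α ∉ Cn (Cn X ∪ ⟦ β ⟧)) → β ∈ ∣ K ÷ α ∣
  retained-unless-relevant K α β∈K irrelevant = em⇒dne em λ β∉K÷α →
    let X , _ , CnX⊆K , α∉CnX , α∈CnX+β = relevance K α _ β∈K β∉K÷α
    in irrelevant X CnX⊆K α∉CnX α∈CnX+β

  vacuity : ∀ K α → α ∉ ∣ K ∣ → ∣ K ÷ α ∣ ≐ ∣ K ∣
  vacuity K α α∉K = inclusion K α , λ β∈K →
    retained-unless-relevant K α β∈K λ X CnX⊆K _ α∈CnX+β →
      α∉K (Cn-closed K (Cn-monotone (∪-⟦⟧-⊆ CnX⊆K β∈K) α∈CnX+β))

  recovery : ∀ K α → ∣ K ∣ ⊆ Cn (∣ K ÷ α ∣ ∪ ⟦ α ⟧)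
  recovery K α {β} β∈K = Cn-mp (Cn-extensive (inj₁ α⇒β∈K÷α)) (Cn-extensive (inj₂ refl))
    where
    α⇒β∈K÷α : (α ⇒ β) ∈ ∣ K ÷ α ∣
    α⇒β∈K÷α = retained-unless-relevant K α (Cn-closed K (Cn-⊢ (Cn-extensive β∈K) ax1))
      λ X _ α∉CnX α∈CnX+α⇒β → α∉CnX (Cn-⊢ (Cn-deduction α∈CnX+α⇒β) ⊢-peirce)

mainTheorem7 : ExcludedMiddle 0ℓ → (_÷_ : Contraction) → IsExtensionalAGM∘ _÷_ →
    ((∀ K α → α ∉ ∣ K ∣ → ∣ K ÷ α ∣ ≐ ∣ K ∣)
    × (∀ K α → ∣ K ∣ ⊆ Cn (∣ K ÷ α ∣ ∪ ⟦ α ⟧)))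
mainTheorem7 em _÷_ agm = vacuity em agm , recovery em agm
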